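{- Let $1\le k<n$ and $I,J\in V_{k,n}$. (1) If $I$ and $J$ are weakly separated, then they are noncrossing. (2) If $I^{+i}$ and $J^{+i}$ are noncrossing for every $i\in[n]$, then $I$ and $J$ are weakly separated. Consequently, the weak separation complex $\Delta^{Sep}_{k,n}$ is the intersection of the complexes obtained from $\Delta^{NC}_{k,n}$ by all cyclic shifts.
   Context: $V_{k,n}$ is the set of $k$-subsets of $[n]$, written as increasing vectors $(i_1,\dots,i_k)$. Arcs $(p<p')$, $(q<q')$ cross if $p<q<p'<q'$ or $q<p<q'<p'$. $I,J\in V_{k,n}$ are noncrossing if for all $1\le a<b\le k$ with $i_\ell=j_\ell$ for all $a<\ell<b$, the arcs $(i_a<i_b)$ and $(j_a<j_b)$ do not cross; $\Delta^{NC}_{k,n}$ is the flag complex on $V_{k,n}$ of pairwise noncrossing sets. $I$ and $J$ are weakly separated if, placing $1,\dots,n$ in this cyclic order as vertices of a convex $n$-gon, the convex hulls of $I\setminus J$ and $J\setminus I$ are disjoint; $\Delta^{Sep}_{k,n}$ is the simplicial complex of pairwise weakly separated subsets of $V_{k,n}$. For $i\in[n]$, $I^{+i}$ is the image of $I$ under $x\mapsto x+i$ taken modulo $n$ with representatives in $[n]$, rewritten as an increasing vector. -}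

module Defs where

open import Data.Nat using (ℕ; zero; suc; _+_; _≤_; _<_)
open import Data.Nat.DivMod using (_%_)
open import Data.Nat.Properties using (≤-decTotalOrder)
open import Data.List using (List; []; _∷_; length; map)
open import Data.List.Membership.Propositional using (_∈_; _∉_)
open import Data.List.Relation.Unary.All using (All)
open import Data.List.Relation.Unary.Linked using (Linked)
open import Data.List.Sort ≤-decTotalOrder using (sort)
open import Data.Product using (_×_; ∃-syntax)
open import Data.Sum using (_⊎_)
open import Relation.Nullary using (¬_)
open import Relation.Binary.PropositionalEquality using (_≡_)

-- 0-based list lookup (default 0 out of range; only used in range)
nth : List ℕ → ℕ → ℕ
nth []       _       = 0
nth (x ∷ xs) zero    = x
nth (x ∷ xs) (suc l) = nth xs l

-- V_{k,n}: k-subsets of [n] = {1,…,n}, written as strictly increasing lists of length k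
record V (k n : ℕ) : Set where
  constructor mkV
  field
    elems   : List ℕ
    len     : length elems ≡ k
    incr    : Linked _<_ elems
    bounded : All (λ x → 1 ≤ x × x ≤ n) elems
open V public

Cross : ℕ → ℕ → ℕ → ℕ → Set
Cross p p' q q' = (p < q × q < p' × p' < q') ⊎ (q < p × p < q' × q' < p')

-- noncrossing for increasing vectors I, J (positions 1..k become indices 0..k-1):
-- for all a < b (both positions) with I_l = J_l for all a < l < b,
-- the arcs (I_a < I_b) and (J_a < J_b) do not cross
NoncrossingL : List ℕ → List ℕ → Set
NoncrossingL I J =
  ∀ a b → a < b → b < length I →
  (∀ l → a < l → l < b → nth I l ≡ nth J l) →
  ¬ Cross (nth I a) (nth I b) (nth J a) (nth J b)

Noncrossing : ∀ {k n} → V k n → V k n → Set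
Noncrossing I J = NoncrossingL (elems I) (elems J)

InDiff : List ℕ → List ℕ → ℕ → Set
InDiff I J x = x ∈ I × x ∉ J

-- a < b < c < d with a, c ∈ A and b, d ∈ B : the points of A and B interleave
-- on the circle, i.e. the convex hulls of A and B (vertices of a convex n-gon) meet
Interleave : (ℕ → Set) → (ℕ → Set) → Set
Interleave A B = ∃[ a ] ∃[ b ] ∃[ c ] ∃[ d ]
  (a < b × b < c × c < d × A a × B b × A c × B d)

WeaklySeparatedL : List ℕ → List ℕ → Set
WeaklySeparatedL I J =
  ¬ Interleave (InDiff I J) (InDiff J I) × ¬ Interleave (InDiff J I) (InDiff I J)

WeaklySeparated : ∀ {k n} → V k n → V k n → Set
WeaklySeparated I J = WeaklySeparatedL (elems I) (elems J)

-- representative in [n] = {1,…,n} of x modulo n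
modRep : ℕ → ℕ → ℕ
modRep zero    x = x
modRep (suc m) x with x % suc m
... | zero  = suc m
... | suc r = suc r

shift : ∀ {k} → (n i : ℕ) → V k n → List ℕ
shift n i I = sort (map (λ x → modRep n (x + i)) (elems I))

SepFace : ∀ {k n} → List (V k n) → Set
SepFace F = ∀ I J → I ∈ F → J ∈ F → WeaklySeparated I J

-- F lies in the complex obtained from Δ^NC_{k,n} by the cyclic shift by i:
-- the shifted sets are pairwise noncrossing (Δ^NC is a flag complex)
ShiftedNCFace : ∀ {k} → (n i : ℕ) → List (V k n) → Set
ShiftedNCFace n i F = ∀ I J → I ∈ F → J ∈ F → NoncrossingL (shift n i I) (shift n i J)

{-# OPTIONS --safe #-}
-- Write rank L t for the number of elements of L below t.
--
-- (1) If I and J cross at positions a < b, say I_a < J_a < I_b < J_b with equal entries in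
-- between, then J_a ∉ I and I_b ∉ J, and comparing ranks yields some x ≤ I_a in I ∖ J and
-- some y ≥ J_b in J ∖ I; so x < J_a < I_b < y interleave.
--
-- (2) If J ∖ I and I ∖ J interleave as a < b < c < d, then [a, b] and [c, d] contain valleys
-- q < p: q ∈ J ∖ I, p ∈ I ∖ J, and I, J agree strictly between them. The balance
-- rank I − rank J drops by one across a valley and rises by at most one per step, so a
-- discrete intermediate value argument gives a cut s outside one of the valleys (q, p) whose
-- balance is one less than at q. Rotating s to 1 keeps that valley intact and leaves I with
-- one more element than J below q; with i = rank J q and j = rank I p the arcs (I_i, I_j)
-- and (J_i, J_j) of the rotated sets then cross.
--
-- (3) Weak separation is invariant under cyclic rotation, so (1) applies to every shift.
module Submission where

open import Defs
open import Data.Nat using (ℕ; zero; suc; _+_; _*_; _∸_; _≤_; _<_; z≤n; s≤s; _<?_; _≤?_; _≟_)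
open import Data.Nat.Properties
open import Relation.Binary.PropositionalEquality
  using (_≡_; _≢_; refl; sym; trans; cong; cong₂; subst; subst₂; setoid; resp₂; ≢-sym; module ≡-Reasoning)
open import Algebra.Properties.CommutativeSemigroup +-commutativeSemigroup using (interchange; xy∙z≈xz∙y)
open import Data.Empty using (⊥-elim)
open import Data.List using (List; []; _∷_; length; map)
open import Data.List.Membership.DecPropositional _≟_ using (_∈?_)
open import Data.List.Membership.Propositional using (_∈_; _∉_)
open import Data.List.Membership.Propositional.Properties using (∈-map⁺; ∈-map⁻)
open import Data.List.Properties using (length-map; map-∘)
open import Data.List.Relation.Binary.Permutation.Propositional using (↭-sym; ↭⇒↭ₛ)
open import Data.List.Relation.Binary.Permutation.Propositional.Properties using (∈-resp-↭; ↭-length)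
  renaming (map⁺ to ↭-map⁺)
open import Data.List.Relation.Binary.Permutation.Setoid.Properties (setoid ℕ) using (AllPairs-resp-↭)
open import Data.List.Relation.Unary.All as All using (All; []; _∷_)
import Data.List.Relation.Unary.All.Properties as All
open import Data.List.Relation.Unary.AllPairs using (AllPairs; []; _∷_)
open import Data.List.Relation.Unary.Any using (here; there)
open import Data.List.Relation.Unary.Linked as Linked using (Linked; []; [-]; _∷_)
open import Data.List.Relation.Unary.Linked.Properties using (Linked⇒All; AllPairs⇒Linked)
open import Data.List.Sort ≤-decTotalOrder using (sort; sort-↭; sort-↗)
open import Data.Nat.DivMod using (_%_; m<n⇒m%n≡m; n%n≡0; [m+n]%n≡m%n)
open import Data.Nat.ListAction using (sum)
open import Data.Nat.ListAction.Properties using (sum-↭)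
open import Data.Product using (_×_; _,_; proj₁; proj₂; ∃-syntax)
open import Data.Sum using (_⊎_; inj₁; inj₂; [_,_]; swap)
open import Function using (id; _∘′_)
open import Function.Bundles using (_⇔_; mk⇔; Equivalence)
open import Relation.Nullary using (¬_; yes; no; contradiction)

variable
  L I J : List ℕ
  a b q p s t u v x y : ℕ

-- Ranks in increasing lists

Increasing : List ℕ → Set
Increasing = Linked _<_

head<tail : ∀ {x xs} → Increasing (x ∷ xs) → All (x <_) xs
head<tail [-]           = []
head<tail (x<y ∷ y∷ys↗) = Linked⇒All <-trans x<y y∷ys↗

nth-∈ : a < length L → nth L a ∈ L
nth-∈ {zero}  {_ ∷ _} _         = here refl
nth-∈ {suc a} {_ ∷ L} (s≤s a<) = there (nth-∈ a<)

∈⇒nth : x ∈ L → ∃[ a ] (a < length L × nth L a ≡ x)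
∈⇒nth (here refl) = 0 , s≤s z≤n , refl
∈⇒nth (there x∈L) with ∈⇒nth x∈L
... | a , a< , eq = suc a , s≤s a< , eq

χ< : ℕ → ℕ → ℕ
χ< _       zero    = 0
χ< zero    (suc _) = 1
χ< (suc x) (suc t) = χ< x t

χ<-< : x < t → χ< x t ≡ 1
χ<-< {zero}  {suc t} _         = refl
χ<-< {suc x} {suc t} (s≤s x<t) = χ<-< x<t

χ<-≥ : t ≤ x → χ< x t ≡ 0
χ<-≥ {zero}  z≤n       = refl
χ<-≥ {suc t} (s≤s t≤x) = χ<-≥ t≤x

χ<-cong : x < t ⇔ y < u → χ< x t ≡ χ< y u
χ<-cong {x} {t} x<t⇔y<u with x <? t
... | yes x<t = trans (χ<-< x<t) (sym (χ<-< (Equivalence.to x<t⇔y<u x<t)))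
... | no  x≮t = trans (χ<-≥ (≮⇒≥ x≮t)) (sym (χ<-≥ (≮⇒≥ (x≮t ∘′ Equivalence.from x<t⇔y<u))))

χ<-monoʳ : t ≤ u → χ< x t ≤ χ< x u
χ<-monoʳ {t} {u} {x} t≤u with x <? t
... | yes x<t = ≤-reflexive (trans (χ<-< x<t) (sym (χ<-< (<-≤-trans x<t t≤u))))
... | no  x≮t = subst (_≤ χ< x u) (sym (χ<-≥ (≮⇒≥ x≮t))) z≤n

χ<≤1 : ∀ x t → χ< x t ≤ 1
χ<≤1 _       zero    = z≤n
χ<≤1 zero    (suc _) = ≤-refl
χ<≤1 (suc x) (suc t) = χ<≤1 x t

rank : List ℕ → ℕ → ℕ
rank L t = sum (map (λ x → χ< x t) L)

rank-zero : ∀ L → rank L 0 ≡ 0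
rank-zero []      = refl
rank-zero (_ ∷ L) = rank-zero L

rank-monoʳ : ∀ L → t ≤ u → rank L t ≤ rank L u
rank-monoʳ []      _   = z≤n
rank-monoʳ (x ∷ L) t≤u = +-mono-≤ (χ<-monoʳ {x = x} t≤u) (rank-monoʳ L t≤u)

rank≤length : ∀ L t → rank L t ≤ length L
rank≤length []      t = z≤n
rank≤length (x ∷ L) t = +-mono-≤ (χ<≤1 x t) (rank≤length L t)

rank-all≥ : All (t ≤_) L → rank L t ≡ 0
rank-all≥ []             = refl
rank-all≥ (t≤x ∷ t≤xs) = cong₂ _+_ (χ<-≥ t≤x) (rank-all≥ t≤xs)

rank-all< : All (_< t) L → rank L t ≡ length L
rank-all< []             = refl
rank-all< (x<t ∷ xs<t) = cong₂ _+_ (χ<-< x<t) (rank-all< xs<t)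

rank-suc-∉ : ∀ L → t ∉ L → rank L (suc t) ≡ rank L t
rank-suc-∉     []      _   = refl
rank-suc-∉ {t} (x ∷ L) t∉ = cong₂ _+_ (χ<-cong x<1+t⇔x<t) (rank-suc-∉ L (t∉ ∘′ there))
  where
  x<1+t⇔x<t : x < suc t ⇔ x < t
  x<1+t⇔x<t = mk⇔ (λ x<1+t → ≤∧≢⇒< (≤-pred x<1+t) (λ x≡t → t∉ (here (sym x≡t)))) m≤n⇒m≤1+n

rank-suc-∈ : Increasing L → t ∈ L → rank L (suc t) ≡ suc (rank L t)
rank-suc-∈ {x ∷ L} L↗ (here refl) = begin
  χ< x (suc x) + rank L (suc x)  ≡⟨ cong₂ _+_ (χ<-< (n<1+n x)) (rank-all≥ {t = suc x} x<L) ⟩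
  1                              ≡⟨ cong suc (cong₂ _+_ (χ<-≥ {t = x} ≤-refl) (rank-all≥ (All.map <⇒≤ x<L))) ⟨
  suc (χ< x x + rank L x)        ∎
  where
  open ≡-Reasoning
  x<L = head<tail L↗
rank-suc-∈ {x ∷ L} {t} L↗ (there t∈L) = begin
  χ< x (suc t) + rank L (suc t)
    ≡⟨ cong₂ _+_ (χ<-cong (mk⇔ (λ _ → x<t) (λ _ → m<n⇒m<1+n x<t))) (rank-suc-∈ (Linked.tail L↗) t∈L) ⟩
  χ< x t + suc (rank L t)        ≡⟨ +-suc (χ< x t) (rank L t) ⟩
  suc (χ< x t + rank L t)        ∎
  where
  open ≡-Reasoning
  x<t : x < t
  x<t = All.lookup (head<tail L↗) t∈L

rank-suc≤ : ∀ L → Increasing L → rank L (suc t) ≤ suc (rank L t)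
rank-suc≤ {t} L L↗ with t ∈? L
... | yes t∈L = ≤-reflexive (rank-suc-∈ L↗ t∈L)
... | no  t∉L = m≤n⇒m≤1+n (≤-reflexive (rank-suc-∉ L t∉L))

rank-nth : Increasing L → a < length L → rank L (nth L a) ≡ a
rank-nth {x ∷ L} {zero}  L↗ _ = rank-all≥ (≤-refl ∷ All.map <⇒≤ (head<tail L↗))
rank-nth {x ∷ L} {suc a} L↗ (s≤s a<) =
  cong₂ _+_ (χ<-< (All.lookup (head<tail L↗) (nth-∈ a<))) (rank-nth (Linked.tail L↗) a<)

rank<length : Increasing L → x ∈ L → rank L x < length L
rank<length {L} {x} L↗ x∈L = begin-strict
  rank L x        <⟨ n<1+n _ ⟩
  suc (rank L x)  ≡⟨ rank-suc-∈ L↗ x∈L ⟨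
  rank L (suc x)  ≤⟨ rank≤length L (suc x) ⟩
  length L        ∎
  where open ≤-Reasoning

nth-rank : Increasing L → x ∈ L → nth L (rank L x) ≡ x
nth-rank {L} L↗ x∈L with ∈⇒nth x∈L
... | a , a< , refl = cong (nth L) (rank-nth L↗ a<)

<rank⇒nth< : Increasing L → a < rank L t → nth L a < t
<rank⇒nth< {L} {a} {t} L↗ a<rank = ≰⇒> λ t≤nth → <⇒≱ a<rank (begin
  rank L t          ≤⟨ rank-monoʳ L t≤nth ⟩
  rank L (nth L a)  ≡⟨ rank-nth L↗ (<-≤-trans a<rank (rank≤length L t)) ⟩
  a                 ∎)
  where open ≤-Reasoning

nth<⇒<rank : Increasing L → a < length L → nth L a < t → a < rank L t
nth<⇒<rank {L} {a} {t} L↗ a< nth<t = begin-strict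
  a                      <⟨ n<1+n a ⟩
  suc a                  ≡⟨ cong suc (rank-nth L↗ a<) ⟨
  suc (rank L (nth L a)) ≡⟨ rank-suc-∈ L↗ (nth-∈ a<) ⟨
  rank L (suc (nth L a)) ≤⟨ rank-monoʳ L nth<t ⟩
  rank L t               ∎
  where open ≤-Reasoning

nth-mono : Increasing L → a < b → b < length L → nth L a < nth L b
nth-mono {L} {a} {b} L↗ a<b b< = <rank⇒nth< L↗ (subst (a <_) (sym (rank-nth L↗ b<)) a<b)

-- Weak separation implies noncrossing

≤-sum : ∀ L → All (_≤ sum L) L
≤-sum []      = []
≤-sum (x ∷ L) = m≤m+n x (sum L) ∷ All.map (λ y≤ → ≤-trans y≤ (m≤n+m (sum L) x)) (≤-sum L)

∃-∈∖-between : Increasing I → Increasing J → t ≤ u →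
               rank I u + rank J t < rank J u + rank I t →
               ∃[ y ] (t ≤ y × y < u × InDiff J I y)
∃-∈∖-between {I} {J} {t} I↗ J↗ t≤u gap with m≤n⇒m<n∨m≡n t≤u
... | inj₂ refl = ⊥-elim (<-irrefl (+-comm (rank I t) (rank J t)) gap)
... | inj₁ (s≤s {n = u} t≤u) with rank I u + rank J t <? rank J u + rank I t
...   | yes gap′ with ∃-∈∖-between I↗ J↗ t≤u gap′
...     | y , t≤y , y<u , y∈J∖I = y , t≤y , m<n⇒m<1+n y<u , y∈J∖I
∃-∈∖-between {I} {J} {t} I↗ J↗ _ gap | inj₁ (s≤s {n = u} t≤u) | no ¬gap′ =
  u , t≤u , n<1+n u , u∈J , u∉I
  where
  open ≤-Reasoning
  u∈J : u ∈ J
  u∈J with u ∈? J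
  ... | yes u∈J = u∈J
  ... | no  u∉J = contradiction gap (≤⇒≯ (begin
    rank J (suc u) + rank I t  ≡⟨ cong (_+ rank I t) (rank-suc-∉ J u∉J) ⟩
    rank J u + rank I t        ≤⟨ ≮⇒≥ ¬gap′ ⟩
    rank I u + rank J t        ≤⟨ +-monoˡ-≤ (rank J t) (rank-monoʳ I (n≤1+n u)) ⟩
    rank I (suc u) + rank J t  ∎))
  u∉I : u ∉ I
  u∉I u∈I = ¬gap′ (+-cancelˡ-< 1 _ _ (begin-strict
    suc (rank I u + rank J t)  ≡⟨ cong (_+ rank J t) (rank-suc-∈ I↗ u∈I) ⟨
    rank I (suc u) + rank J t  <⟨ gap ⟩
    rank J (suc u) + rank I t  ≤⟨ +-monoˡ-≤ (rank I t) (rank-suc≤ J J↗) ⟩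
    suc (rank J u + rank I t)  ∎))

∃-∈∖-≤-nth : Increasing I → Increasing J → a < length I → a < length J →
             nth I a < nth J a → ∃[ x ] (x ≤ nth I a × InDiff I J x)
∃-∈∖-≤-nth {I} {J} {a} I↗ J↗ a<I a<J Iₐ<Jₐ with ∃-∈∖-between J↗ I↗ z≤n gap
  where
  open ≤-Reasoning
  gap : rank J (suc (nth I a)) + rank I 0 < rank I (suc (nth I a)) + rank J 0
  gap = begin-strict
    rank J (suc (nth I a)) + rank I 0  ≡⟨ cong₂ _+_ refl (rank-zero I) ⟩
    rank J (suc (nth I a)) + 0         ≡⟨ +-identityʳ _ ⟩
    rank J (suc (nth I a))             ≤⟨ rank-monoʳ J Iₐ<Jₐ ⟩
    rank J (nth J a)                   ≡⟨ rank-nth J↗ a<J ⟩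
    a                                  <⟨ n<1+n a ⟩
    suc a                              ≡⟨ cong suc (rank-nth I↗ a<I) ⟨
    suc (rank I (nth I a))             ≡⟨ rank-suc-∈ I↗ (nth-∈ a<I) ⟨
    rank I (suc (nth I a))             ≡⟨ +-identityʳ _ ⟨
    rank I (suc (nth I a)) + 0         ≡⟨ cong₂ _+_ refl (rank-zero J) ⟨
    rank I (suc (nth I a)) + rank J 0  ∎
... | x , _ , x<1+Iₐ , x∈I∖J = x , ≤-pred x<1+Iₐ , x∈I∖J

∃-∈∖-≥-nth : Increasing I → Increasing J → length I ≡ length J → b < length I →
             nth I b < nth J b → ∃[ y ] (nth J b ≤ y × InDiff J I y)
∃-∈∖-≥-nth {I} {J} {b} I↗ J↗ |I|≡|J| b<I Iᵦ<Jᵦ with ∃-∈∖-between I↗ J↗ Jᵦ≤T gap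
  where
  open ≤-Reasoning
  T = suc (sum I + sum J)
  b<J = subst (b <_) |I|≡|J| b<I
  Jᵦ≤T : nth J b ≤ T
  Jᵦ≤T = m≤n⇒m≤1+n (≤-trans (All.lookup (≤-sum J) (nth-∈ b<J)) (m≤n+m (sum J) (sum I)))
  rank-T-I : rank I T ≡ length I
  rank-T-I = rank-all< (All.map (λ x≤ → s≤s (≤-trans x≤ (m≤m+n (sum I) (sum J)))) (≤-sum I))
  rank-T-J : rank J T ≡ length J
  rank-T-J = rank-all< (All.map (λ x≤ → s≤s (≤-trans x≤ (m≤n+m (sum J) (sum I)))) (≤-sum J))
  gap : rank I T + rank J (nth J b) < rank J T + rank I (nth J b)
  gap = begin-strict
    rank I T + rank J (nth J b)  ≡⟨ cong₂ _+_ rank-T-I (rank-nth J↗ b<J) ⟩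
    length I + b                 <⟨ +-monoʳ-< (length I) (nth<⇒<rank I↗ b<I Iᵦ<Jᵦ) ⟩
    length I + rank I (nth J b)  ≡⟨ cong (_+ rank I (nth J b)) (trans |I|≡|J| (sym rank-T-J)) ⟩
    rank J T + rank I (nth J b)  ∎
... | y , Jᵦ≤y , _ , y∈J∖I = y , Jᵦ≤y , y∈J∖I

∈⇒nth-between : Increasing I → a < b → b < length I → x ∈ I → nth I a < x → x < nth I b →
                ∃[ l ] (a < l × l < b × nth I l ≡ x)
∈⇒nth-between {I} {a} {b} {x} I↗ a<b b<I x∈I Iₐ<x x<Iᵦ =
  rank I x , a<rank , rank<b , nth-rank I↗ x∈I
  where
  a<rank : a < rank I x
  a<rank = nth<⇒<rank I↗ (<-trans a<b b<I) Iₐ<x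
  rank<b : rank I x < b
  rank<b = subst (rank I x <_) (rank-nth I↗ b<I)
             (nth<⇒<rank I↗ (rank<length I↗ x∈I) (subst (_< nth I b) (sym (nth-rank I↗ x∈I)) x<Iᵦ))

EntriesAgree : List ℕ → List ℕ → ℕ → ℕ → Set
EntriesAgree I J a b = ∀ l → a < l → l < b → nth I l ≡ nth J l

crossing⇒interleave : Increasing I → Increasing J → length I ≡ length J →
                      a < b → b < length I → EntriesAgree I J a b →
                      nth I a < nth J a → nth J a < nth I b → nth I b < nth J b →
                      Interleave (InDiff I J) (InDiff J I)
crossing⇒interleave {I} {J} {a} {b} I↗ J↗ |I|≡|J| a<b b<I agree Iₐ<Jₐ Jₐ<Iᵦ Iᵦ<Jᵦ
  with ∃-∈∖-≤-nth I↗ J↗ (<-trans a<b b<I) (<-trans a<b (subst (b <_) |I|≡|J| b<I)) Iₐ<Jₐ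
     | ∃-∈∖-≥-nth I↗ J↗ |I|≡|J| b<I Iᵦ<Jᵦ
... | x , x≤Iₐ , x∈I∖J | y , Jᵦ≤y , y∈J∖I =
  x , nth J a , nth I b , y , ≤-<-trans x≤Iₐ Iₐ<Jₐ , Jₐ<Iᵦ , <-≤-trans Iᵦ<Jᵦ Jᵦ≤y ,
  x∈I∖J , (nth-∈ (<-trans a<b b<J) , Jₐ∉I) , (nth-∈ b<I , Iᵦ∉J) , y∈J∖I
  where
  b<J = subst (b <_) |I|≡|J| b<I
  Jₐ∉I : nth J a ∉ I
  Jₐ∉I Jₐ∈I with ∈⇒nth-between I↗ a<b b<I Jₐ∈I Iₐ<Jₐ Jₐ<Iᵦ
  ... | l , a<l , l<b , Iₗ≡Jₐ =
    <-irrefl (trans (sym Iₗ≡Jₐ) (agree l a<l l<b)) (nth-mono J↗ a<l (<-trans l<b b<J))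
  Iᵦ∉J : nth I b ∉ J
  Iᵦ∉J Iᵦ∈J with ∈⇒nth-between J↗ a<b b<J Iᵦ∈J Jₐ<Iᵦ Iᵦ<Jᵦ
  ... | l , a<l , l<b , Jₗ≡Iᵦ =
    <-irrefl (trans (agree l a<l l<b) Jₗ≡Iᵦ) (nth-mono I↗ l<b b<I)

weaklySeparated⇒noncrossing : Increasing I → Increasing J → length I ≡ length J →
                              WeaklySeparatedL I J → NoncrossingL I J
weaklySeparated⇒noncrossing I↗ J↗ |I|≡|J| (¬IJIJ , _) a b a<b b<I agree (inj₁ (c₁ , c₂ , c₃)) =
  ¬IJIJ (crossing⇒interleave I↗ J↗ |I|≡|J| a<b b<I agree c₁ c₂ c₃)
weaklySeparated⇒noncrossing I↗ J↗ |I|≡|J| (_ , ¬JIJI) a b a<b b<I agree (inj₂ (c₁ , c₂ , c₃)) =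
  ¬JIJI (crossing⇒interleave J↗ I↗ (sym |I|≡|J|) a<b (subst (b <_) |I|≡|J| b<I)
                             (λ l a<l l<b → sym (agree l a<l l<b)) c₁ c₂ c₃)

-- Valleys

MembersAgree : List ℕ → List ℕ → ℕ → ℕ → Set
MembersAgree I J u v = ∀ z → u ≤ z → z < v → z ∈ I ⇔ z ∈ J

rank-agree : Increasing I → Increasing J → MembersAgree I J u v → u ≤ t → t ≤ v →
             rank I t + rank J u ≡ rank I u + rank J t
rank-agree {I} {J} {u} I↗ J↗ agree u≤t t≤v with m≤n⇒m<n∨m≡n u≤t
... | inj₂ refl = refl
... | inj₁ (s≤s {n = t} u≤t) with rank-agree I↗ J↗ agree u≤t (<⇒≤ t≤v) | t ∈? I
...   | ih | yes t∈I = begin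
  rank I (suc t) + rank J u    ≡⟨ cong (_+ rank J u) (rank-suc-∈ I↗ t∈I) ⟩
  suc (rank I t + rank J u)    ≡⟨ cong suc ih ⟩
  suc (rank I u + rank J t)    ≡⟨ +-suc (rank I u) (rank J t) ⟨
  rank I u + suc (rank J t)    ≡⟨ cong (rank I u +_) (rank-suc-∈ J↗ (Equivalence.to (agree t u≤t t≤v) t∈I)) ⟨
  rank I u + rank J (suc t)    ∎
  where open ≡-Reasoning
...   | ih | no  t∉I = begin
  rank I (suc t) + rank J u    ≡⟨ cong (_+ rank J u) (rank-suc-∉ I t∉I) ⟩
  rank I t + rank J u          ≡⟨ ih ⟩
  rank I u + rank J t          ≡⟨ cong (rank I u +_) (rank-suc-∉ J t∉J) ⟨
  rank I u + rank J (suc t)    ∎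
  where
  open ≡-Reasoning
  t∉J : t ∉ J
  t∉J = t∉I ∘′ Equivalence.from (agree t u≤t t≤v)

membersAgree-empty : ∀ u → MembersAgree I J u u
membersAgree-empty u z u≤z z<u = ⊥-elim (<-irrefl refl (<-≤-trans z<u u≤z))

record Valley (I J : List ℕ) (q p : ℕ) : Set where
  field
    q<p     : q < p
    q∈J∖I   : InDiff J I q
    p∈I∖J   : InDiff I J p
    between : MembersAgree I J (suc q) p

InDiff-trichotomy : ∀ I J z → InDiff I J z ⊎ InDiff J I z ⊎ (z ∈ I ⇔ z ∈ J)
InDiff-trichotomy I J z with z ∈? I | z ∈? J
... | yes z∈I | yes z∈J = inj₂ (inj₂ (mk⇔ (λ _ → z∈J) (λ _ → z∈I)))
... | yes z∈I | no  z∉J = inj₁ (z∈I , z∉J)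
... | no  z∉I | yes z∈J = inj₂ (inj₁ (z∈J , z∉I))
... | no  z∉I | no  z∉J = inj₂ (inj₂ (mk⇔ (⊥-elim ∘′ z∉I) (⊥-elim ∘′ z∉J)))

∃-valley-from : ∀ d z → z + d ≡ b → q < z → InDiff J I q → InDiff I J b →
                MembersAgree I J (suc q) z → ∃[ q′ ] ∃[ p ] (q ≤ q′ × p ≤ b × Valley I J q′ p)
∃-valley-from {q = q} {J = J} {I = I} d z z+d≡b q<z q∈J∖I b∈I∖J agree with InDiff-trichotomy I J z
... | inj₁ z∈I∖J =
  q , z , ≤-refl , subst (z ≤_) z+d≡b (m≤m+n z d) ,
  record { q<p = q<z ; q∈J∖I = q∈J∖I ; p∈I∖J = z∈I∖J ; between = agree }
∃-valley-from zero z z+0≡b _ _ (b∈I , b∉J) _ | inj₂ z∉I∖J with trans (sym (+-identityʳ z)) z+0≡b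
... | refl with z∉I∖J
...   | inj₁ (_ , b∉I) = contradiction b∈I b∉I
...   | inj₂ b∈I⇔b∈J   = contradiction (Equivalence.to b∈I⇔b∈J b∈I) b∉J
∃-valley-from (suc d) z z+1+d≡b q<z q∈J∖I b∈I∖J agree | inj₂ (inj₁ z∈J∖I)
  with ∃-valley-from d (suc z) (trans (sym (+-suc z d)) z+1+d≡b) (n<1+n z) z∈J∖I b∈I∖J
                     (membersAgree-empty (suc z))
... | q′ , p , z≤q′ , p≤b , V = q′ , p , ≤-trans (<⇒≤ q<z) z≤q′ , p≤b , V
∃-valley-from {q = q} {J = J} {I = I} (suc d) z z+1+d≡b q<z q∈J∖I b∈I∖J agree
  | inj₂ (inj₂ z∈I⇔z∈J) =
  ∃-valley-from d (suc z) (trans (sym (+-suc z d)) z+1+d≡b) (m<n⇒m<1+n q<z) q∈J∖I b∈I∖J agree′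
  where
  agree′ : MembersAgree I J (suc q) (suc z)
  agree′ w q<w w<1+z with m≤n⇒m<n∨m≡n (≤-pred w<1+z)
  ... | inj₁ w<z  = agree w q<w w<z
  ... | inj₂ refl = z∈I⇔z∈J

∃-valley : InDiff J I a → InDiff I J b → a < b → ∃[ q ] ∃[ p ] (a ≤ q × p ≤ b × Valley I J q p)
∃-valley {a = a} a∈J∖I b∈I∖J a<b with m≤n⇒∃[o]m+o≡n a<b
... | d , 1+a+d≡b = ∃-valley-from d (suc a) 1+a+d≡b (n<1+n a) a∈J∖I b∈I∖J (membersAgree-empty (suc a))

Crossing : List ℕ → List ℕ → Set
Crossing I J = ∃[ a ] ∃[ b ] (a < b × b < length I × EntriesAgree I J a b ×
                              Cross (nth I a) (nth I b) (nth J a) (nth J b))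

crossing⇒¬noncrossing : Crossing I J → ¬ NoncrossingL I J
crossing⇒¬noncrossing (a , b , a<b , b<I , agree , cross) nc = nc a b a<b b<I agree cross

valley-rank≡ : Increasing I → Increasing J → Valley I J q p → rank I q ≡ suc (rank J q) →
               q < t → t ≤ p → rank I t ≡ rank J t
valley-rank≡ {I} {J} {q} {p} {t} I↗ J↗ V excess q<t t≤p =
  +-cancelʳ-≡ (suc (rank J q)) (rank I t) (rank J t) (begin
    rank I t + suc (rank J q)  ≡⟨ cong (rank I t +_) (rank-suc-∈ J↗ (proj₁ q∈J∖I)) ⟨
    rank I t + rank J (suc q)  ≡⟨ rank-agree I↗ J↗ between q<t t≤p ⟩
    rank I (suc q) + rank J t  ≡⟨ cong (_+ rank J t) (trans (rank-suc-∉ I (proj₂ q∈J∖I)) excess) ⟩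
    suc (rank J q) + rank J t  ≡⟨ +-comm (suc (rank J q)) (rank J t) ⟩
    rank J t + suc (rank J q)  ∎)
  where
  open Valley V
  open ≡-Reasoning

-- The arcs at positions i = rank J q and j = rank I p cross: J_i = q and I_j = p.
valley⇒crossing : Increasing I → Increasing J → length I ≡ length J → Valley I J q p →
                  rank I q ≡ suc (rank J q) → Crossing I J
valley⇒crossing {I} {J} {q} {p} I↗ J↗ |I|≡|J| V excess =
  i , j , i<j , j<I , agree , inj₁ (Iᵢ<Jᵢ , Jᵢ<Iⱼ , Iⱼ<Jⱼ)
  where
  open Valley V
  open ≡-Reasoning
  i = rank J q
  j = rank I p
  i<rankIq : i < rank I q
  i<rankIq = subst (i <_) (sym excess) (n<1+n i)
  j<I : j < length I
  j<I = rank<length I↗ (proj₁ p∈I∖J)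
  j<J : j < length J
  j<J = subst (j <_) |I|≡|J| j<I
  i<j : i < j
  i<j = <-≤-trans i<rankIq (rank-monoʳ I (<⇒≤ q<p))
  Jᵢ≡q : nth J i ≡ q
  Jᵢ≡q = nth-rank J↗ (proj₁ q∈J∖I)
  Iⱼ≡p : nth I j ≡ p
  Iⱼ≡p = nth-rank I↗ (proj₁ p∈I∖J)
  rank-I≡rank-J : q < t → t ≤ p → rank I t ≡ rank J t
  rank-I≡rank-J = valley-rank≡ I↗ J↗ V excess
  Iᵢ<Jᵢ : nth I i < nth J i
  Iᵢ<Jᵢ = subst (nth I i <_) (sym Jᵢ≡q) (<rank⇒nth< I↗ i<rankIq)
  Jᵢ<Iⱼ : nth J i < nth I j
  Jᵢ<Iⱼ = subst₂ _<_ (sym Jᵢ≡q) (sym Iⱼ≡p) q<p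
  Iⱼ<Jⱼ : nth I j < nth J j
  Iⱼ<Jⱼ = subst (_< nth J j) (sym Iⱼ≡p) (≤∧≢⇒< (≮⇒≥ Jⱼ≮p) p≢Jⱼ)
    where
    Jⱼ≮p : ¬ nth J j < p
    Jⱼ≮p Jⱼ<p = <-irrefl (rank-I≡rank-J q<p ≤-refl) (nth<⇒<rank J↗ j<J Jⱼ<p)
    p≢Jⱼ : p ≢ nth J j
    p≢Jⱼ p≡Jⱼ = proj₂ p∈I∖J (subst (_∈ J) (sym p≡Jⱼ) (nth-∈ j<J))
  agree : EntriesAgree I J i j
  agree l i<l l<j = begin
    nth I l                   ≡⟨ nth-rank J↗ Iₗ∈J ⟨
    nth J (rank J (nth I l))  ≡⟨ cong (nth J) (trans (sym (rank-I≡rank-J q<Iₗ (<⇒≤ Iₗ<p))) (rank-nth I↗ l<I)) ⟩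
    nth J l                   ∎
    where
    l<I = <-trans l<j j<I
    Iₗ<p : nth I l < p
    Iₗ<p = subst (nth I l <_) Iⱼ≡p (nth-mono I↗ l<j j<I)
    q<Iₗ : q < nth I l
    q<Iₗ = ≰⇒> λ Iₗ≤q → <⇒≱ i<l (≤-pred (subst (l <_) (trans (rank-suc-∉ I (proj₂ q∈J∖I)) excess)
                                                      (nth<⇒<rank I↗ l<I (s≤s Iₗ≤q))))
    Iₗ∈J : nth I l ∈ J
    Iₗ∈J = Equivalence.to (between (nth I l) q<Iₗ Iₗ<p) (nth-∈ l<I)

-- Cyclic rotations

InRange : ℕ → ℕ → Set
InRange n x = 1 ≤ x × x ≤ n

modRep-≡ : ∀ m y {r} → 1 ≤ r → r ≤ suc m → y % suc m ≡ r % suc m → modRep (suc m) y ≡ r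
modRep-≡ m y {suc r} _ 1+r≤1+m y≡r with m≤n⇒m<n∨m≡n 1+r≤1+m
... | inj₁ 1+r<1+m = remainder-suc (trans y≡r (m<n⇒m%n≡m 1+r<1+m))
  where
  remainder-suc : y % suc m ≡ suc r → modRep (suc m) y ≡ suc r
  remainder-suc eq with y % suc m | eq
  ... | _ | refl = refl
... | inj₂ refl = remainder-zero (trans y≡r (n%n≡0 (suc m)))
  where
  remainder-zero : y % suc m ≡ 0 → modRep (suc m) y ≡ suc m
  remainder-zero eq with y % suc m | eq
  ... | _ | refl = refl

shiftL : ℕ → ℕ → List ℕ → List ℕ
shiftL n i L = sort (map (λ x → modRep n (x + i)) L)

length-shiftL : ∀ n i L → length (shiftL n i L) ≡ length L
length-shiftL n i L = trans (↭-length (sort-↭ (map _ L))) (length-map _ L)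

shiftL-sameLength : ∀ n i → length I ≡ length J → length (shiftL n i I) ≡ length (shiftL n i J)
shiftL-sameLength {I} {J} n i |I|≡|J| = trans (length-shiftL n i I) (trans |I|≡|J| (sym (length-shiftL n i J)))

-- ρ rotates [1, n] by i and sends the cut s to 1. Lifting the points below s by n
-- (unroll) makes it order-preserving: ρ x + n ≡ unroll x + i.
module Rotation (m i s : ℕ) (s+i≡2+m : s + i ≡ suc (suc m)) (1≤s : 1 ≤ s) where

  private
    n = suc m

  ρ : ℕ → ℕ
  ρ x = modRep n (x + i)

  unroll : ℕ → ℕ
  unroll x = x + χ< x s * n

  unroll-low : x < s → unroll x ≡ x + n
  unroll-low {x} x<s = trans (cong (λ c → x + c * n) (χ<-< x<s)) (cong (x +_) (+-identityʳ n))

  unroll-high : s ≤ x → unroll x ≡ x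
  unroll-high {x} s≤x = trans (cong (λ c → x + c * n) (χ<-≥ s≤x)) (+-identityʳ x)

  i≤n : i ≤ n
  i≤n = ≤-pred (subst (suc i ≤_) s+i≡2+m (+-monoˡ-≤ i 1≤s))

  ρ-unroll : InRange n x → ρ x + n ≡ unroll x + i
  ρ-unroll {x} (1≤x , x≤n) with x <? s
  ... | yes x<s = begin
    ρ x + n       ≡⟨ cong (_+ n) (modRep-≡ m (x + i) (≤-trans 1≤x (m≤m+n x i)) x+i≤n refl) ⟩
    x + i + n     ≡⟨ xy∙z≈xz∙y x i n ⟩
    x + n + i     ≡⟨ cong (_+ i) (unroll-low x<s) ⟨
    unroll x + i  ∎
    where
    open ≡-Reasoning
    x+i≤n = ≤-pred (subst (x + i <_) s+i≡2+m (+-monoˡ-< i x<s))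
  ... | no  x≮s with m≤n⇒∃[o]m+o≡n (subst (_≤ x + i) s+i≡2+m (+-monoˡ-≤ i (≮⇒≥ x≮s)))
  ...   | r , 1+n+r≡x+i = begin
    ρ x + n                   ≡⟨ cong (λ y → modRep n y + n) x+i≡1+r+n ⟩
    modRep n (suc r + n) + n  ≡⟨ cong (_+ n) (modRep-≡ m (suc r + n) (s≤s z≤n) 1+r≤n ([m+n]%n≡m%n (suc r) n)) ⟩
    suc r + n                 ≡⟨ x+i≡1+r+n ⟨
    x + i                     ≡⟨ cong (_+ i) (unroll-high (≮⇒≥ x≮s)) ⟨
    unroll x + i              ∎
    where
    open ≡-Reasoning
    x+i≡1+r+n : x + i ≡ suc r + n
    x+i≡1+r+n = trans (sym 1+n+r≡x+i) (cong suc (+-comm n r))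
    1+r≤n : suc r ≤ n
    1+r≤n = +-cancelˡ-≤ n (suc r) n
              (subst (_≤ n + n) (trans x+i≡1+r+n (+-comm (suc r) n)) (+-mono-≤ x≤n i≤n))

  high<low : InRange n x → InRange n y → s ≤ x → y < s → unroll x < unroll y
  high<low (_ , x≤n) (1≤y , _) s≤x y<s =
    subst₂ _<_ (sym (unroll-high s≤x)) (sym (unroll-low y<s)) (≤-trans (s≤s x≤n) (+-monoˡ-≤ n 1≤y))

  low<low⇔ : x < s → y < s → unroll x < unroll y ⇔ x < y
  low<low⇔ {x} {y} x<s y<s =
    subst₂ (λ u v → u < v ⇔ x < y) (sym (unroll-low x<s)) (sym (unroll-low y<s))
           (mk⇔ (+-cancelʳ-< n x y) (+-monoˡ-< n))

  high<high⇔ : s ≤ x → s ≤ y → unroll x < unroll y ⇔ x < y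
  high<high⇔ {x} {y} s≤x s≤y =
    subst₂ (λ u v → u < v ⇔ x < y) (sym (unroll-high s≤x)) (sym (unroll-high s≤y)) (mk⇔ id id)

  unroll<-from-low : InRange n x → InRange n y → x < s → unroll x < unroll y → y < s × x < y
  unroll<-from-low {y = y} x∈ y∈ x<s ux<uy with y <? s
  ... | yes y<s = y<s , Equivalence.to (low<low⇔ x<s y<s) ux<uy
  ... | no  y≮s = contradiction ux<uy (<-asym (high<low y∈ x∈ (≮⇒≥ y≮s) x<s))

  unroll<-to-high : InRange n x → InRange n y → s ≤ y → unroll x < unroll y → s ≤ x × x < y
  unroll<-to-high {x} x∈ y∈ s≤y ux<uy with x <? s
  ... | yes x<s = contradiction ux<uy (<-asym (high<low y∈ x∈ s≤y x<s))
  ... | no  x≮s = ≮⇒≥ x≮s , Equivalence.to (high<high⇔ (≮⇒≥ x≮s) s≤y) ux<uy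

  unroll-injective : InRange n x → InRange n y → unroll x ≡ unroll y → x ≡ y
  unroll-injective {x} {y} x∈ y∈ ux≡uy with x <? s | y <? s
  ... | yes x<s | yes y<s = +-cancelʳ-≡ n x y (trans (sym (unroll-low x<s)) (trans ux≡uy (unroll-low y<s)))
  ... | no  x≮s | no  y≮s = trans (sym (unroll-high (≮⇒≥ x≮s))) (trans ux≡uy (unroll-high (≮⇒≥ y≮s)))
  ... | yes x<s | no  y≮s = contradiction ux≡uy (<⇒≢ (high<low y∈ x∈ (≮⇒≥ y≮s) x<s) ∘′ sym)
  ... | no  x≮s | yes y<s = contradiction ux≡uy (<⇒≢ (high<low x∈ y∈ (≮⇒≥ x≮s) y<s))

  ρ<ρ⇔ : InRange n x → InRange n y → ρ x < ρ y ⇔ unroll x < unroll y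
  ρ<ρ⇔ x∈ y∈ = mk⇔
    (λ ρx<ρy → +-cancelʳ-< i _ _ (subst₂ _<_ (ρ-unroll x∈) (ρ-unroll y∈) (+-monoˡ-< n ρx<ρy)))
    (λ ux<uy → +-cancelʳ-< n _ _ (subst₂ _<_ (sym (ρ-unroll x∈)) (sym (ρ-unroll y∈)) (+-monoˡ-< i ux<uy)))

  ρ-injective : InRange n x → InRange n y → ρ x ≡ ρ y → x ≡ y
  ρ-injective {x} {y} x∈ y∈ ρx≡ρy = unroll-injective x∈ y∈
    (+-cancelʳ-≡ i (unroll x) (unroll y) (trans (sym (ρ-unroll x∈)) (trans (cong (_+ n) ρx≡ρy) (ρ-unroll y∈))))

  χ<-unroll : InRange n x → InRange n y →
              χ< (unroll x) (unroll y) + χ< x s ≡ χ< x y + χ< y s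
  χ<-unroll {x} {y} x∈ y∈ with x <? s | y <? s
  ... | yes x<s | yes y<s =
    cong₂ _+_ (χ<-cong (low<low⇔ x<s y<s)) (trans (χ<-< x<s) (sym (χ<-< y<s)))
  ... | no  x≮s | no  y≮s =
    cong₂ _+_ (χ<-cong (high<high⇔ (≮⇒≥ x≮s) (≮⇒≥ y≮s))) (trans (χ<-≥ (≮⇒≥ x≮s)) (sym (χ<-≥ (≮⇒≥ y≮s))))
  ... | yes x<s | no  y≮s =
    trans (cong₂ _+_ (χ<-≥ (<⇒≤ (high<low y∈ x∈ (≮⇒≥ y≮s) x<s))) (χ<-< x<s))
          (sym (cong₂ _+_ (χ<-< (<-≤-trans x<s (≮⇒≥ y≮s))) (χ<-≥ (≮⇒≥ y≮s))))
  ... | no  x≮s | yes y<s =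
    trans (cong₂ _+_ (χ<-< (high<low x∈ y∈ (≮⇒≥ x≮s) y<s)) (χ<-≥ (≮⇒≥ x≮s)))
          (sym (cong₂ _+_ (χ<-≥ (<⇒≤ (<-≤-trans y<s (≮⇒≥ x≮s)))) (χ<-< y<s)))

  S : List ℕ → List ℕ
  S = shiftL n i

  ρ∈S : x ∈ L → ρ x ∈ S L
  ρ∈S {L = L} x∈L = ∈-resp-↭ (↭-sym (sort-↭ (map ρ L))) (∈-map⁺ ρ x∈L)

  ∈S⇒ρ∈ : y ∈ S L → ∃[ x ] (x ∈ L × y ≡ ρ x)
  ∈S⇒ρ∈ {L = L} y∈SL = ∈-map⁻ ρ (∈-resp-↭ (sort-↭ (map ρ L)) y∈SL)

  ρ∈S⇒∈ : All (InRange n) L → InRange n x → ρ x ∈ S L → x ∈ L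
  ρ∈S⇒∈ L⊆ x∈ ρx∈SL with ∈S⇒ρ∈ ρx∈SL
  ... | x′ , x′∈L , ρx≡ρx′ = subst (_∈ _) (sym (ρ-injective x∈ (All.lookup L⊆ x′∈L) ρx≡ρx′)) x′∈L

  ρ-distinct : Increasing L → All (InRange n) L → AllPairs _≢_ (map ρ L)
  ρ-distinct {[]}    _  _            = []
  ρ-distinct {x ∷ L} L↗ (x∈ ∷ L⊆) =
    All.map⁺ (All.zipWith (λ (x<y , y∈) ρx≡ρy → <-irrefl (ρ-injective x∈ y∈ ρx≡ρy) x<y) (head<tail L↗ , L⊆))
    ∷ ρ-distinct (Linked.tail L↗) L⊆

  S-increasing : Increasing L → All (InRange n) L → Increasing (S L)
  S-increasing {L} L↗ L⊆ =
    Linked.zipWith (λ (x≤y , x≢y) → ≤∧≢⇒< x≤y x≢y) (sort-↗ (map ρ L) , AllPairs⇒Linked distinct)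
    where
    distinct : AllPairs _≢_ (S L)
    distinct = AllPairs-resp-↭ ≢-sym (resp₂ _≢_) (↭⇒↭ₛ (↭-sym (sort-↭ (map ρ L)))) (ρ-distinct L↗ L⊆)

  rank-S : ∀ L → All (InRange n) L → InRange n q →
           rank (S L) (ρ q) + rank L s ≡ rank L q + length L * χ< q s
  rank-S {q} L L⊆ q∈ = trans (cong (_+ rank L s) rank-S≡) (count L L⊆)
    where
    open ≡-Reasoning
    rank-S≡ : rank (S L) (ρ q) ≡ sum (map (λ x → χ< (ρ x) (ρ q)) L)
    rank-S≡ = trans (sum-↭ (↭-map⁺ (λ y → χ< y (ρ q)) (sort-↭ (map ρ L)))) (cong sum (sym (map-∘ L)))
    count : ∀ L → All (InRange n) L →
            sum (map (λ x → χ< (ρ x) (ρ q)) L) + rank L s ≡ rank L q + length L * χ< q s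
    count []      []         = refl
    count (x ∷ L) (x∈ ∷ L⊆) = begin
      (χ< (ρ x) (ρ q) + Σρ) + (χ< x s + rank L s)  ≡⟨ interchange (χ< (ρ x) (ρ q)) Σρ (χ< x s) (rank L s) ⟩
      (χ< (ρ x) (ρ q) + χ< x s) + (Σρ + rank L s)  ≡⟨ cong₂ _+_ pointwise (count L L⊆) ⟩
      (χ< x q + χ< q s) + (rank L q + length L * χ< q s)
        ≡⟨ interchange (χ< x q) (χ< q s) (rank L q) (length L * χ< q s) ⟩
      (χ< x q + rank L q) + (χ< q s + length L * χ< q s)  ∎
      where
      Σρ = sum (map (λ x → χ< (ρ x) (ρ q)) L)
      pointwise : χ< (ρ x) (ρ q) + χ< x s ≡ χ< x q + χ< q s
      pointwise = trans (cong (_+ χ< x s) (χ<-cong (ρ<ρ⇔ x∈ q∈))) (χ<-unroll x∈ q∈)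

  S-excess : All (InRange n) I → All (InRange n) J → length I ≡ length J → InRange n q →
             rank I q + rank J s ≡ suc (rank J q + rank I s) →
             rank (S I) (ρ q) ≡ suc (rank (S J) (ρ q))
  S-excess {I} {J} {q} I⊆ J⊆ |I|≡|J| q∈ excess = +-cancelʳ-≡ (Is + Js) X (suc Y) (begin
    X + (Is + Js)        ≡⟨ +-assoc X Is Js ⟨
    (X + Is) + Js        ≡⟨ cong (_+ Js) (rank-S I I⊆ q∈) ⟩
    (Iq + c) + Js        ≡⟨ xy∙z≈xz∙y Iq c Js ⟩
    (Iq + Js) + c        ≡⟨ cong (_+ c) excess ⟩
    suc (Jq + Is) + c    ≡⟨ cong suc (xy∙z≈xz∙y Jq Is c) ⟩
    suc ((Jq + c) + Is)  ≡⟨ cong (λ z → suc (z + Is)) Jq+c≡Y+Js ⟩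
    suc ((Y + Js) + Is)  ≡⟨ cong suc (trans (xy∙z≈xz∙y Y Js Is) (+-assoc Y Is Js)) ⟩
    suc Y + (Is + Js)    ∎)
    where
    open ≡-Reasoning
    X = rank (S I) (ρ q)
    Y = rank (S J) (ρ q)
    Iq = rank I q
    Jq = rank J q
    Is = rank I s
    Js = rank J s
    c = length I * χ< q s
    Jq+c≡Y+Js : Jq + c ≡ Y + Js
    Jq+c≡Y+Js = trans (cong (λ k → Jq + k * χ< q s) |I|≡|J|) (sym (rank-S J J⊆ q∈))

  S-valley : All (InRange n) I → All (InRange n) J → Valley I J q p → s ≤ q ⊎ p < s →
             Valley (S I) (S J) (ρ q) (ρ p)
  S-valley {I} {J} {q} {p} I⊆ J⊆ V side = record
    { q<p     = Equivalence.from (ρ<ρ⇔ q∈ p∈) (unroll-q<p side)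
    ; q∈J∖I   = ρ∈S (proj₁ q∈J∖I) , proj₂ q∈J∖I ∘′ ρ∈S⇒∈ I⊆ q∈
    ; p∈I∖J   = ρ∈S (proj₁ p∈I∖J) , proj₂ p∈I∖J ∘′ ρ∈S⇒∈ J⊆ p∈
    ; between = λ z ρq<z z<ρp →
        mk⇔ (transport I⊆ (λ q<x x<p → Equivalence.to (between′ _ q<x x<p)) ρq<z z<ρp)
            (transport J⊆ (λ q<x x<p → Equivalence.from (between′ _ q<x x<p)) ρq<z z<ρp)
    }
    where
    open Valley V renaming (between to between′)
    q∈ = All.lookup J⊆ (proj₁ q∈J∖I)
    p∈ = All.lookup I⊆ (proj₁ p∈I∖J)
    unroll-q<p : s ≤ q ⊎ p < s → unroll q < unroll p
    unroll-q<p (inj₁ s≤q) = Equivalence.from (high<high⇔ s≤q (≤-trans s≤q (<⇒≤ q<p))) q<p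
    unroll-q<p (inj₂ p<s) = Equivalence.from (low<low⇔ (<-trans q<p p<s) p<s) q<p
    inside : s ≤ q ⊎ p < s → InRange n x → unroll q < unroll x → unroll x < unroll p → q < x × x < p
    inside (inj₁ s≤q) x∈ uq<ux ux<up with unroll<-to-high x∈ p∈ (≤-trans s≤q (<⇒≤ q<p)) ux<up
    ... | s≤x , x<p = Equivalence.to (high<high⇔ s≤q s≤x) uq<ux , x<p
    inside (inj₂ p<s) x∈ uq<ux ux<up with unroll<-from-low q∈ x∈ (<-trans q<p p<s) uq<ux
    ... | x<s , q<x = q<x , Equivalence.to (low<low⇔ x<s p<s) ux<up
    transport : ∀ {K K′ z} → All (InRange n) K → (∀ {x} → q < x → x < p → x ∈ K → x ∈ K′) →
                ρ q < z → z < ρ p → z ∈ S K → z ∈ S K′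
    transport K⊆ K→K′ ρq<z z<ρp z∈SK with ∈S⇒ρ∈ z∈SK
    ... | x , x∈K , refl = ρ∈S (K→K′ (proj₁ q<x<p) (proj₂ q<x<p) x∈K)
      where
      x∈ = All.lookup K⊆ x∈K
      q<x<p = inside side x∈ (Equivalence.to (ρ<ρ⇔ q∈ x∈) ρq<z) (Equivalence.to (ρ<ρ⇔ x∈ p∈) z<ρp)

  excess-cut⇒crossing : Increasing I → Increasing J → length I ≡ length J →
                 All (InRange n) I → All (InRange n) J → Valley I J q p → s ≤ q ⊎ p < s →
                 rank I q + rank J s ≡ suc (rank J q + rank I s) → Crossing (S I) (S J)
  excess-cut⇒crossing {I} {J} I↗ J↗ |I|≡|J| I⊆ J⊆ V side excess =
    valley⇒crossing (S-increasing I↗ I⊆) (S-increasing J↗ J⊆)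
      (shiftL-sameLength n i |I|≡|J|)
      (S-valley I⊆ J⊆ V side) (S-excess I⊆ J⊆ |I|≡|J| (All.lookup J⊆ (proj₁ (Valley.q∈J∖I V))) excess)

  -- In unrolled order the points ≥ s come first, so the natural order is a cyclic shift.
  unroll-interleave : ∀ {A B : ℕ → Set} {c d} →
                      InRange n a → InRange n b → InRange n c → InRange n d →
                      unroll a < unroll b → unroll b < unroll c → unroll c < unroll d →
                      A a → B b → A c → B d → Interleave A B ⊎ Interleave B A
  unroll-interleave {a} {b} {c = c} {d} a∈ b∈ c∈ d∈ ua<ub ub<uc uc<ud Aa Bb Ac Bd with a <? s
  ... | yes a<s =
    let (b<s , a<b) = unroll<-from-low a∈ b∈ a<s ua<ub
        (c<s , b<c) = unroll<-from-low b∈ c∈ b<s ub<uc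
        (_   , c<d) = unroll<-from-low c∈ d∈ c<s uc<ud
    in inj₁ (a , b , c , d , a<b , b<c , c<d , Aa , Bb , Ac , Bd)
  ... | no a≮s with d <? s
  ...   | no d≮s =
    let (s≤c , c<d) = unroll<-to-high c∈ d∈ (≮⇒≥ d≮s) uc<ud
        (s≤b , b<c) = unroll<-to-high b∈ c∈ s≤c ub<uc
        (_   , a<b) = unroll<-to-high a∈ b∈ s≤b ua<ub
    in inj₁ (a , b , c , d , a<b , b<c , c<d , Aa , Bb , Ac , Bd)
  ...   | yes d<s with b <? s
  ...     | yes b<s =
    let (c<s , b<c) = unroll<-from-low b∈ c∈ b<s ub<uc
        (_   , c<d) = unroll<-from-low c∈ d∈ c<s uc<ud
    in inj₂ (b , c , d , a , b<c , c<d , <-≤-trans d<s (≮⇒≥ a≮s) , Bb , Ac , Bd , Aa)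
  ...     | no b≮s with c <? s
  ...       | yes c<s =
    let (_ , c<d) = unroll<-from-low c∈ d∈ c<s uc<ud
        (_ , a<b) = unroll<-to-high a∈ b∈ (≮⇒≥ b≮s) ua<ub
    in inj₁ (c , d , a , b , c<d , <-≤-trans d<s (≮⇒≥ a≮s) , a<b , Ac , Bd , Aa , Bb)
  ...       | no c≮s =
    let (s≤b , b<c) = unroll<-to-high b∈ c∈ (≮⇒≥ c≮s) ub<uc
        (_   , a<b) = unroll<-to-high a∈ b∈ s≤b ua<ub
    in inj₂ (d , a , b , c , <-≤-trans d<s (≮⇒≥ a≮s) , a<b , b<c , Bd , Aa , Bb , Ac)

  InDiff-S⇒ : All (InRange n) I → InDiff (S I) (S J) y → ∃[ x ] (InDiff I J x × InRange n x × y ≡ ρ x)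
  InDiff-S⇒ I⊆ (y∈SI , y∉SJ) with ∈S⇒ρ∈ y∈SI
  ... | x , x∈I , refl = x , (x∈I , y∉SJ ∘′ ρ∈S) , All.lookup I⊆ x∈I , refl

  S-interleave : All (InRange n) I → All (InRange n) J →
                 Interleave (InDiff (S I) (S J)) (InDiff (S J) (S I)) →
                 Interleave (InDiff I J) (InDiff J I) ⊎ Interleave (InDiff J I) (InDiff I J)
  S-interleave I⊆ J⊆ (_ , _ , _ , _ , ρa<ρb , ρb<ρc , ρc<ρd , Aρa , Bρb , Aρc , Bρd)
    with InDiff-S⇒ I⊆ Aρa | InDiff-S⇒ J⊆ Bρb | InDiff-S⇒ I⊆ Aρc | InDiff-S⇒ J⊆ Bρd
  ... | a , Aa , a∈ , refl | b , Bb , b∈ , refl | c , Ac , c∈ , refl | d , Bd , d∈ , refl =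
    unroll-interleave a∈ b∈ c∈ d∈ (Equivalence.to (ρ<ρ⇔ a∈ b∈) ρa<ρb) (Equivalence.to (ρ<ρ⇔ b∈ c∈) ρb<ρc)
                      (Equivalence.to (ρ<ρ⇔ c∈ d∈) ρc<ρd) Aa Bb Ac Bd

  S-weaklySeparated : All (InRange n) I → All (InRange n) J →
                      WeaklySeparatedL I J → WeaklySeparatedL (S I) (S J)
  S-weaklySeparated I⊆ J⊆ (¬IJIJ , ¬JIJI) =
    [ ¬IJIJ , ¬JIJI ] ∘′ S-interleave I⊆ J⊆ , [ ¬JIJI , ¬IJIJ ] ∘′ S-interleave J⊆ I⊆

-- Noncrossing rotations imply weak separation

discrete-ivt : ∀ (f g : ℕ → ℕ) → (∀ y → f (suc y) ≤ suc (f y)) → (∀ y → g y ≤ g (suc y)) →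
               ∀ {y₁ y₂} → y₁ ≤ y₂ → f y₁ ≤ g y₁ → g y₂ ≤ f y₂ →
               ∃[ y ] (y₁ ≤ y × y ≤ y₂ × f y ≡ g y)
discrete-ivt f g f-step g-mono {y₁} y₁≤y₂ f≤g g≤f with m≤n⇒m<n∨m≡n y₁≤y₂
... | inj₂ refl = y₁ , ≤-refl , ≤-refl , ≤-antisym f≤g g≤f
... | inj₁ (s≤s {n = y} y₁≤y) with g y ≤? f y
...   | yes g≤f′ with discrete-ivt f g f-step g-mono y₁≤y f≤g g≤f′
...     | z , y₁≤z , z≤y , fz≡gz = z , y₁≤z , m≤n⇒m≤1+n z≤y , fz≡gz
discrete-ivt f g f-step g-mono _ _ g≤f | inj₁ (s≤s {n = y} y₁≤y) | no g≰f =
  suc y , m≤n⇒m≤1+n y₁≤y , ≤-refl , ≤-antisym (≤-trans (f-step y) (≤-trans (≰⇒> g≰f) (g-mono y))) g≤f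

-- After rotating s to 1, the valley (q, p) is intact and I has one more element than J
-- below q (Rotation.S-excess).
ExcessCut : List ℕ → List ℕ → ℕ → ℕ → ℕ → Set
ExcessCut I J n q p =
  ∃[ s ] (1 ≤ s × s ≤ n × (s ≤ q ⊎ p < s) × rank I q + rank J s ≡ suc (rank J q + rank I s))

excessCut-after : ∀ {n q₁ p₁ q₂ p₂} → Increasing I → Increasing J →
                  Valley I J q₁ p₁ → Valley I J q₂ p₂ → p₁ ≤ q₂ → p₂ ≤ n →
                  rank I q₂ + rank J q₁ ≤ rank I q₁ + rank J q₂ → ExcessCut I J n q₁ p₁
excessCut-after {I} {J} {n} {q₁} {p₁} {q₂} {p₂} I↗ J↗ V₁ V₂ p₁≤q₂ p₂≤n balance
  with discrete-ivt f g f-step g-mono (s≤s p₁≤q₂) f≤g g≤f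
  where
  open ≤-Reasoning
  module V₁ = Valley V₁
  module V₂ = Valley V₂
  f g : ℕ → ℕ
  f y = rank I q₁ + rank J y
  g y = suc (rank J q₁ + rank I y)
  f-step : ∀ y → f (suc y) ≤ suc (f y)
  f-step y = ≤-trans (+-monoʳ-≤ (rank I q₁) (rank-suc≤ J J↗)) (≤-reflexive (+-suc (rank I q₁) (rank J y)))
  g-mono : ∀ y → g y ≤ g (suc y)
  g-mono y = s≤s (+-monoʳ-≤ (rank J q₁) (rank-monoʳ I (n≤1+n y)))
  f≤g : f (suc p₁) ≤ g (suc p₁)
  f≤g = begin
    rank I q₁ + rank J (suc p₁)         ≡⟨ cong (rank I q₁ +_) (rank-suc-∉ J (proj₂ V₁.p∈I∖J)) ⟩
    rank I q₁ + rank J p₁               ≡⟨ cong (_+ rank J p₁) (rank-suc-∉ I (proj₂ V₁.q∈J∖I)) ⟨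
    rank I (suc q₁) + rank J p₁         ≡⟨ rank-agree I↗ J↗ V₁.between V₁.q<p ≤-refl ⟨
    rank I p₁ + rank J (suc q₁)         ≡⟨ cong (rank I p₁ +_) (rank-suc-∈ J↗ (proj₁ V₁.q∈J∖I)) ⟩
    rank I p₁ + suc (rank J q₁)         ≡⟨ +-comm (rank I p₁) (suc (rank J q₁)) ⟩
    suc (rank J q₁ + rank I p₁)         ≤⟨ s≤s (+-monoʳ-≤ (rank J q₁) (n≤1+n (rank I p₁))) ⟩
    suc (rank J q₁ + suc (rank I p₁))   ≡⟨ cong (λ r → suc (rank J q₁ + r)) (rank-suc-∈ I↗ (proj₁ V₁.p∈I∖J)) ⟨
    suc (rank J q₁ + rank I (suc p₁))   ∎
  g≤f : g (suc q₂) ≤ f (suc q₂)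
  g≤f = begin
    suc (rank J q₁ + rank I (suc q₂))   ≡⟨ cong (λ r → suc (rank J q₁ + r)) (rank-suc-∉ I (proj₂ V₂.q∈J∖I)) ⟩
    suc (rank J q₁ + rank I q₂)         ≡⟨ cong suc (+-comm (rank J q₁) (rank I q₂)) ⟩
    suc (rank I q₂ + rank J q₁)         ≤⟨ s≤s balance ⟩
    suc (rank I q₁ + rank J q₂)         ≡⟨ +-suc (rank I q₁) (rank J q₂) ⟨
    rank I q₁ + suc (rank J q₂)         ≡⟨ cong (rank I q₁ +_) (rank-suc-∈ J↗ (proj₁ V₂.q∈J∖I)) ⟨
    rank I q₁ + rank J (suc q₂)         ∎
... | s , 1+p₁≤s , s≤1+q₂ , excess =
  s , ≤-trans (s≤s z≤n) 1+p₁≤s , ≤-trans s≤1+q₂ (≤-trans (Valley.q<p V₂) p₂≤n) , inj₂ 1+p₁≤s , excess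

excessCut-before : ∀ {n q₁ p₁ q₂ p₂} → Increasing I → Increasing J →
                   Valley I J q₁ p₁ → Valley I J q₂ p₂ → p₁ ≤ q₂ → p₂ ≤ n →
                   rank I q₁ + rank J q₂ ≤ rank I q₂ + rank J q₁ → ExcessCut I J n q₂ p₂
excessCut-before {I} {J} {n} {q₁} {p₁} {q₂} {p₂} I↗ J↗ V₁ V₂ p₁≤q₂ p₂≤n balance
  with discrete-ivt f g f-step g-mono (<-≤-trans V₁.q<p p₁≤q₂) f≤g g≤f
  where
  open ≤-Reasoning
  module V₁ = Valley V₁
  module V₂ = Valley V₂
  f g : ℕ → ℕ
  f y = suc (rank J q₂ + rank I y)
  g y = rank I q₂ + rank J y
  f-step : ∀ y → f (suc y) ≤ suc (f y)
  f-step y = s≤s (≤-trans (+-monoʳ-≤ (rank J q₂) (rank-suc≤ I I↗)) (≤-reflexive (+-suc (rank J q₂) (rank I y))))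
  g-mono : ∀ y → g y ≤ g (suc y)
  g-mono y = +-monoʳ-≤ (rank I q₂) (rank-monoʳ J (n≤1+n y))
  f≤g : f (suc q₁) ≤ g (suc q₁)
  f≤g = begin
    suc (rank J q₂ + rank I (suc q₁))   ≡⟨ cong (λ r → suc (rank J q₂ + r)) (rank-suc-∉ I (proj₂ V₁.q∈J∖I)) ⟩
    suc (rank J q₂ + rank I q₁)         ≡⟨ cong suc (+-comm (rank J q₂) (rank I q₁)) ⟩
    suc (rank I q₁ + rank J q₂)         ≤⟨ s≤s balance ⟩
    suc (rank I q₂ + rank J q₁)         ≡⟨ +-suc (rank I q₂) (rank J q₁) ⟨
    rank I q₂ + suc (rank J q₁)         ≡⟨ cong (rank I q₂ +_) (rank-suc-∈ J↗ (proj₁ V₁.q∈J∖I)) ⟨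
    rank I q₂ + rank J (suc q₁)         ∎
  g≤f : g q₂ ≤ f q₂
  g≤f = begin
    rank I q₂ + rank J q₂               ≡⟨ +-comm (rank I q₂) (rank J q₂) ⟩
    rank J q₂ + rank I q₂               <⟨ n<1+n _ ⟩
    suc (rank J q₂ + rank I q₂)         ∎
... | s , 1+q₁≤s , s≤q₂ , excess =
  s , ≤-trans (s≤s z≤n) 1+q₁≤s , ≤-trans s≤q₂ (≤-trans (<⇒≤ (Valley.q<p V₂)) p₂≤n) , inj₁ s≤q₂ , sym excess

NoncrossingShifts : ℕ → List ℕ → List ℕ → Set
NoncrossingShifts n I J = ∀ i → 1 ≤ i → i ≤ n → NoncrossingL (shiftL n i I) (shiftL n i J)

noncrossing-sym : length I ≡ length J → NoncrossingL I J → NoncrossingL J I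
noncrossing-sym |I|≡|J| nc a b a<b b<J agree cross =
  nc a b a<b (subst (b <_) (sym |I|≡|J|) b<J) (λ l a<l l<b → sym (agree l a<l l<b)) (swap cross)

noncrossingShifts-sym : ∀ n → length I ≡ length J → NoncrossingShifts n I J → NoncrossingShifts n J I
noncrossingShifts-sym {I} {J} n |I|≡|J| nc i 1≤i i≤n =
  noncrossing-sym {shiftL n i I} {shiftL n i J} (shiftL-sameLength n i |I|≡|J|) (nc i 1≤i i≤n)

noncrossingShifts⇒¬excessCut : ∀ m → Increasing I → Increasing J → length I ≡ length J →
                               All (InRange (suc m)) I → All (InRange (suc m)) J →
                               NoncrossingShifts (suc m) I J → Valley I J q p → ¬ ExcessCut I J (suc m) q p
noncrossingShifts⇒¬excessCut {I} {J} m I↗ J↗ |I|≡|J| I⊆ J⊆ nc V (s , 1≤s , s≤n , side , excess) =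
  crossing⇒¬noncrossing {S I} {S J} (excess-cut⇒crossing I↗ J↗ |I|≡|J| I⊆ J⊆ V side excess)
                                    (nc i (m<n⇒0<n∸m (s≤s s≤n)) i≤n)
  where
  i = suc (suc m) ∸ s
  open Rotation m i s (m+[n∸m]≡n (m≤n⇒m≤1+n s≤n)) 1≤s

two-valleys⇒excessCut : ∀ {n q₁ p₁ q₂ p₂} → Increasing I → Increasing J →
                        Valley I J q₁ p₁ → Valley I J q₂ p₂ → p₁ ≤ q₂ → p₂ ≤ n →
                        ExcessCut I J n q₁ p₁ ⊎ ExcessCut I J n q₂ p₂
two-valleys⇒excessCut {I} {J} {q₁ = q₁} {q₂ = q₂} I↗ J↗ V₁ V₂ p₁≤q₂ p₂≤n
  with ≤-total (rank I q₂ + rank J q₁) (rank I q₁ + rank J q₂)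
... | inj₁ balance = inj₁ (excessCut-after I↗ J↗ V₁ V₂ p₁≤q₂ p₂≤n balance)
... | inj₂ balance = inj₂ (excessCut-before I↗ J↗ V₁ V₂ p₁≤q₂ p₂≤n balance)

noncrossingShifts⇒¬interleave : ∀ m → Increasing I → Increasing J → length I ≡ length J →
                                All (InRange (suc m)) I → All (InRange (suc m)) J →
                                NoncrossingShifts (suc m) I J → ¬ Interleave (InDiff J I) (InDiff I J)
noncrossingShifts⇒¬interleave {I} {J} m I↗ J↗ |I|≡|J| I⊆ J⊆ nc
                              (a , b , c , d , a<b , b<c , c<d , a∈ , b∈ , c∈ , d∈)
  with ∃-valley a∈ b∈ a<b | ∃-valley c∈ d∈ c<d
... | q₁ , p₁ , _ , p₁≤b , V₁ | q₂ , p₂ , c≤q₂ , p₂≤d , V₂ =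
  [ ¬excessCut V₁ , ¬excessCut V₂ ] (two-valleys⇒excessCut I↗ J↗ V₁ V₂ p₁≤q₂ p₂≤n)
  where
  ¬excessCut : Valley I J q p → ¬ ExcessCut I J (suc m) q p
  ¬excessCut = noncrossingShifts⇒¬excessCut m I↗ J↗ |I|≡|J| I⊆ J⊆ nc
  p₁≤q₂ = ≤-trans p₁≤b (≤-trans (<⇒≤ b<c) c≤q₂)
  p₂≤n = proj₂ (All.lookup I⊆ (proj₁ (Valley.p∈I∖J V₂)))

noncrossingShifts⇒weaklySeparated : ∀ m → Increasing I → Increasing J → length I ≡ length J →
                                    All (InRange (suc m)) I → All (InRange (suc m)) J →
                                    NoncrossingShifts (suc m) I J → WeaklySeparatedL I J
noncrossingShifts⇒weaklySeparated {I} {J} m I↗ J↗ |I|≡|J| I⊆ J⊆ nc =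
  noncrossingShifts⇒¬interleave m J↗ I↗ (sym |I|≡|J|) J⊆ I⊆
                                (noncrossingShifts-sym {I} {J} (suc m) |I|≡|J| nc) ,
  noncrossingShifts⇒¬interleave m I↗ J↗ |I|≡|J| I⊆ J⊆ nc

weaklySeparated⇒shiftNoncrossing : ∀ m i → i ≤ suc m → Increasing I → Increasing J → length I ≡ length J →
                                   All (InRange (suc m)) I → All (InRange (suc m)) J →
                                   WeaklySeparatedL I J → NoncrossingL (shiftL (suc m) i I) (shiftL (suc m) i J)
weaklySeparated⇒shiftNoncrossing {I} {J} m i i≤n I↗ J↗ |I|≡|J| I⊆ J⊆ ws =
  weaklySeparated⇒noncrossing (S-increasing I↗ I⊆) (S-increasing J↗ J⊆)
    (shiftL-sameLength (suc m) i |I|≡|J|)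
    (S-weaklySeparated I⊆ J⊆ ws)
  where
  open Rotation m i (suc (suc m) ∸ i) (m∸n+n≡m (m≤n⇒m≤1+n i≤n)) (m<n⇒0<n∸m (s≤s i≤n))

proposition5p2 : ∀ {k n : ℕ} → 1 ≤ k → k < n →
    (∀ (I J : V k n) → WeaklySeparated I J → Noncrossing I J)
    × (∀ (I J : V k n) →
         (∀ i → 1 ≤ i → i ≤ n → NoncrossingL (shift n i I) (shift n i J)) →
         WeaklySeparated I J)
    × (∀ (F : List (V k n)) →
         (SepFace F → ∀ i → 1 ≤ i → i ≤ n → ShiftedNCFace n i F)
         × ((∀ i → 1 ≤ i → i ≤ n → ShiftedNCFace n i F) → SepFace F))
proposition5p2 {k} {zero}  _ ()
proposition5p2 {k} {suc m} _ _ =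
  separated⇒noncrossing , shifts⇒separated , λ F → sepFace⇒shifted F , shifted⇒sepFace F
  where
  sameLength : ∀ (I J : V k (suc m)) → length (elems I) ≡ length (elems J)
  sameLength I J = trans (len I) (sym (len J))
  separated⇒noncrossing : ∀ (I J : V k (suc m)) → WeaklySeparated I J → Noncrossing I J
  separated⇒noncrossing I J = weaklySeparated⇒noncrossing (incr I) (incr J) (sameLength I J)
  shifts⇒separated : ∀ (I J : V k (suc m)) → NoncrossingShifts (suc m) (elems I) (elems J) → WeaklySeparated I J
  shifts⇒separated I J =
    noncrossingShifts⇒weaklySeparated m (incr I) (incr J) (sameLength I J) (bounded I) (bounded J)
  sepFace⇒shifted : ∀ F → SepFace F → ∀ i → 1 ≤ i → i ≤ suc m → ShiftedNCFace (suc m) i F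
  sepFace⇒shifted F sep i _ i≤n I J I∈F J∈F =
    weaklySeparated⇒shiftNoncrossing m i i≤n (incr I) (incr J) (sameLength I J) (bounded I) (bounded J)
                                     (sep I J I∈F J∈F)
  shifted⇒sepFace : ∀ F → (∀ i → 1 ≤ i → i ≤ suc m → ShiftedNCFace (suc m) i F) → SepFace F
  shifted⇒sepFace F nc I J I∈F J∈F = shifts⇒separated I J (λ i 1≤i i≤n → nc i 1≤i i≤n I J I∈F J∈F)
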